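{- For $0\le k\le n$: if $n$ is even then $D(n,k)=D(n,n-k)$ and $\widetilde{D}(n,k)=\widetilde{D}(n,n-k)$; if $n$ is odd then $D(n,k)=\widetilde{D}(n,n-k)$ and $\widetilde{D}(n,k)=D(n,n-k)$.
   Context: $\mathcal{B}_n$ is the group of permutations $\sigma$ of $\{ -n,\dots,n\}$ with $\sigma(-k)=-\sigma(k)$ for all $k$. For $\sigma\in\mathcal{B}_n$, $\mathrm{desc}(\sigma)$ is the number of $i\in\{0,\dots,n-1\}$ with $\sigma(i)>\sigma(i+1)$ (descends of $(0,\sigma(1),\dots,\sigma(n))$). $\mathcal{D}_n$ is the set of $\sigma\in\mathcal{B}_n$ such that $\{\sigma(1),\dots,\sigma(n)\}$ contains an even number of negative elements, and $\widetilde{\mathcal{D}}_n=\mathcal{B}_n\setminus\mathcal{D}_n$. $D(n,k)=\#\{\sigma\in\mathcal{D}_n:\mathrm{desc}(\sigma)=k\}$ and $\widetilde{D}(n,k)=\#\{\sigma\in\widetilde{\mathcal{D}}_n:\mathrm{desc}(\sigma)=k\}$. -}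

module Defs where

open import Data.Bool using (Bool; true; false; _∧_; not; if_then_else_)
open import Data.Nat using (ℕ; zero; suc; _≡ᵇ_; _+_)
open import Data.Nat.Properties using ()
open import Data.Integer as ℤ using (ℤ; +_; -[1+_]; ∣_∣; _<?_)
open import Relation.Nullary.Decidable using (⌊_⌋)
open import Data.List using (List; []; _∷_; map; concatMap; filterᵇ; length; upTo; all)
open import Data.Vec using (Vec; []; _∷_; toList)

-- A signed permutation σ ∈ B_n is determined by the vector (σ(1),…,σ(n)) of
-- integers; σ(-k) = -σ(k) and σ(0) = 0 are then forced.

nonzeroRange : ℕ → List ℤ
nonzeroRange n = map (λ i → + suc i) (upTo n) Data.List.++ map -[1+_] (upTo n)

allVecs : {A : Set} → List A → (m : ℕ) → List (Vec A m)
allVecs L zero = [] ∷ []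
allVecs L (suc m) = concatMap (λ x → map (x ∷_) (allVecs L m)) L

memᵇ : ℕ → List ℕ → Bool
memᵇ x [] = false
memᵇ x (y ∷ ys) = if x ≡ᵇ y then true else memᵇ x ys

distinctᵇ : List ℕ → Bool
distinctᵇ [] = true
distinctᵇ (x ∷ xs) = not (memᵇ x xs) ∧ distinctᵇ xs

-- (σ(1),…,σ(n)) with entries in {-n..n}∖{0} comes from some σ ∈ B_n iff
-- the absolute values |σ(1)|,…,|σ(n)| are pairwise distinct (hence a
-- permutation of {1,…,n}).
isSignedPermᵇ : {n : ℕ} → Vec ℤ n → Bool
isSignedPermᵇ v = distinctᵇ (map ∣_∣ (toList v))

signedPerms : (n : ℕ) → List (Vec ℤ n)
signedPerms n = filterᵇ isSignedPermᵇ (allVecs (nonzeroRange n) n)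

infix 4 _<ᵇ_
_<ᵇ_ : ℤ → ℤ → Bool
x <ᵇ y = ⌊ x <? y ⌋

descList : List ℤ → ℕ
descList [] = 0
descList (x ∷ []) = 0
descList (x ∷ y ∷ ys) = (if y <ᵇ x then 1 else 0) + descList (y ∷ ys)

desc : {n : ℕ} → Vec ℤ n → ℕ
desc v = descList (+ 0 ∷ toList v)

negCount : {n : ℕ} → Vec ℤ n → ℕ
negCount v = length (filterᵇ (λ x → x <ᵇ (+ 0)) (toList v))

evenᵇ : ℕ → Bool
evenᵇ zero = true
evenᵇ (suc m) = not (evenᵇ m)

D : ℕ → ℕ → ℕ
D n k = length (filterᵇ (λ v → evenᵇ (negCount v) ∧ (desc v ≡ᵇ k)) (signedPerms n))

D̃ : ℕ → ℕ → ℕ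
D̃ n k = length (filterᵇ (λ v → not (evenᵇ (negCount v)) ∧ (desc v ≡ᵇ k)) (signedPerms n))

data Even : ℕ → Set where
  even0  : Even zero
  even+2 : {m : ℕ} → Even m → Even (suc (suc m))

Odd : ℕ → Set
Odd n = Even (suc n)

module Submission where

-- Negation v ↦ -v (applied to every entry of (σ(1),…,σ(n)))
-- is a bijection of the signed permutations B_n.  Adjacent entries of
-- (0, σ(1), …, σ(n)) are distinct, so each of the n adjacent pairs is a
-- descent of exactly one of σ and -σ, giving desc σ + desc (-σ) = n.
-- Entries are nonzero, so each is negative in exactly one of σ and -σ,
-- giving neg σ + neg (-σ) = n.  Counting the elements of B_n with a given
-- parity of neg and a given desc through this bijection yields the result:
-- for n even, neg σ and neg (-σ) have the same parity, for n odd opposite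
-- parities, and desc σ = k iff desc (-σ) = n - k.

open import Defs
open import Data.Nat using (ℕ; _≤_; _∸_)
open import Data.Product using (_×_)
open import Relation.Binary.PropositionalEquality using (_≡_)

open import Data.Bool using (Bool; true; false; _∧_; not; if_then_else_; T)
open import Data.Bool.Properties using (not-involutive; not-injective; T-∧)
open import Data.Nat using (zero; suc; pred; _+_; _≡ᵇ_; _≟_)
open import Data.Nat.Properties using (m+n∸n≡m; m+n∸m≡n; m∸[m∸n]≡n; ≡⇒≡ᵇ)
open import Data.Nat.Tactic.RingSolver using (solve-∀)
open import Data.Integer using (ℤ; +_; -_; -[1+_]; ∣_∣; _<?_)
open import Data.Integer.Properties using (neg-mono-<; neg-cancel-<; <-asym; ≮⇒≥; ≤-antisym; ∣-i∣≡∣i∣)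
open import Data.List using (List; []; _∷_; _++_; map; concatMap; length; filterᵇ; upTo)
open import Data.List.Properties using (map-∘; map-++; map-cong; concatMap-map; concatMap-cong; map-concatMap)
open import Data.List.Relation.Unary.All as All using (All; []; _∷_)
open import Data.List.Relation.Unary.All.Properties as AllP using (all-filter)
open import Data.List.Relation.Unary.Linked using (Linked; []; [-]; _∷_)
open import Data.List.Relation.Binary.Permutation.Propositional as ↭ using (_↭_; ↭-refl; ↭-sym; ↭-trans; ↭-reflexive)
open import Data.List.Relation.Binary.Permutation.Propositional.Properties using (↭-length; filter-↭; ++⁺ˡ; ++⁺; shifts; ++-comm; map⁺)
open import Data.Vec as Vec using (Vec; []; _∷_; toList)
open import Data.Vec.Properties using (toList-map; length-toList)
open import Data.Product using (_,_; proj₁; proj₂)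
open import Data.Empty using (⊥-elim)
open import Function using (_∘_; mk⇔; Equivalence)
open import Relation.Nullary.Decidable using (T?; does; isYes; isYes≗does; does-⇔; yes; no)
open import Relation.Binary.PropositionalEquality using (_≢_; refl; sym; trans; cong; cong₂; ≢-sym; module ≡-Reasoning)

χ : Bool → ℕ
χ b = if b then 1 else 0

count : {A : Set} → (A → Bool) → List A → ℕ
count p xs = length (filterᵇ p xs)

count-∷ : {A : Set} (p : A → Bool) (x : A) (xs : List A) →
  count p (x ∷ xs) ≡ χ (p x) + count p xs
count-∷ p x xs with p x
... | true  = refl
... | false = refl

count-cong : {A : Set} {p q : A → Bool} {xs : List A} →
  All (λ x → p x ≡ q x) xs → count p xs ≡ count q xs
count-cong {p = p} {q} {[]} [] = refl
count-cong {p = p} {q} {x ∷ xs} (px≡qx ∷ agree) = begin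
  count p (x ∷ xs)      ≡⟨ count-∷ p x xs ⟩
  χ (p x) + count p xs  ≡⟨ cong₂ _+_ (cong χ px≡qx) (count-cong agree) ⟩
  χ (q x) + count q xs  ≡⟨ count-∷ q x xs ⟨
  count q (x ∷ xs)      ∎
  where open ≡-Reasoning

count-map : {A B : Set} (p : B → Bool) (f : A → B) (xs : List A) →
  count p (map f xs) ≡ count (p ∘ f) xs
count-map p f [] = refl
count-map p f (x ∷ xs) = begin
  count p (f x ∷ map f xs)        ≡⟨ count-∷ p (f x) (map f xs) ⟩
  χ (p (f x)) + count p (map f xs) ≡⟨ cong (λ c → χ (p (f x)) + c) (count-map p f xs) ⟩
  χ (p (f x)) + count (p ∘ f) xs   ≡⟨ count-∷ (p ∘ f) x xs ⟨
  count (p ∘ f) (x ∷ xs)           ∎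
  where open ≡-Reasoning

count-↭ : {A : Set} (p : A → Bool) {xs ys : List A} → xs ↭ ys → count p xs ≡ count p ys
count-↭ p xs↭ys = ↭-length (filter-↭ (T? ∘ p) xs↭ys)

count-image : {A : Set} (p : A → Bool) (f : A → A) {xs : List A} →
  map f xs ↭ xs → count p xs ≡ count (p ∘ f) xs
count-image p f {xs} fxs↭xs = trans (count-↭ p (↭-sym fxs↭xs)) (count-map p f xs)

concatMap-↭ : {A B : Set} {f g : A → List B} {xs ys : List A} →
  xs ↭ ys → (∀ x → f x ↭ g x) → concatMap f xs ↭ concatMap g ys
concatMap-↭ {f = f} {g} {xs} xs↭ys f↭g = ↭-trans (blocks xs) (reorder xs↭ys)
  where
  blocks : ∀ zs → concatMap f zs ↭ concatMap g zs
  blocks []       = ↭-refl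
  blocks (z ∷ zs) = ++⁺ (f↭g z) (blocks zs)

  reorder : ∀ {zs ws} → zs ↭ ws → concatMap g zs ↭ concatMap g ws
  reorder ↭.refl            = ↭-refl
  reorder (↭.prep z p)      = ++⁺ˡ (g z) (reorder p)
  reorder (↭.swap z w p)    = ↭-trans (shifts (g z) (g w)) (++⁺ˡ (g w) (++⁺ˡ (g z) (reorder p)))
  reorder (↭.trans p q)     = ↭-trans (reorder p) (reorder q)

allVecs-↭ : {A : Set} {L L′ : List A} → L ↭ L′ → (m : ℕ) → allVecs L m ↭ allVecs L′ m
allVecs-↭ L↭L′ zero    = ↭-refl
allVecs-↭ L↭L′ (suc m) = concatMap-↭ L↭L′ (λ x → map⁺ (x ∷_) (allVecs-↭ L↭L′ m))

allVecs-map : {A B : Set} (f : A → B) (L : List A) (m : ℕ) →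
  allVecs (map f L) m ≡ map (Vec.map f) (allVecs L m)
allVecs-map f L zero    = refl
allVecs-map f L (suc m) = begin
  concatMap (λ y → map (y ∷_) (allVecs (map f L) m)) (map f L)
    ≡⟨ concatMap-map (λ y → map (y ∷_) (allVecs (map f L) m)) f L ⟩
  concatMap (λ x → map (f x ∷_) (allVecs (map f L) m)) L
    ≡⟨ concatMap-cong (λ x → cong (map (f x ∷_)) (allVecs-map f L m)) L ⟩
  concatMap (λ x → map (f x ∷_) (map (Vec.map f) (allVecs L m))) L
    ≡⟨ concatMap-cong (λ x → trans (sym (map-∘ (allVecs L m))) (map-∘ (allVecs L m))) L ⟩
  concatMap (λ x → map (Vec.map f) (map (x ∷_) (allVecs L m))) L
    ≡⟨ map-concatMap (Vec.map f) (λ x → map (x ∷_) (allVecs L m)) L ⟨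
  map (Vec.map f) (concatMap (λ x → map (x ∷_) (allVecs L m)) L)
    ∎
  where open ≡-Reasoning

allVecs-All : {A : Set} {P : A → Set} {L : List A} → All P L →
  (m : ℕ) → All (λ v → All P (toList v)) (allVecs L m)
allVecs-All PL zero    = [] ∷ []
allVecs-All PL (suc m) =
  AllP.concat⁺ (AllP.map⁺ (All.map (λ Px → AllP.map⁺ (All.map (Px ∷_) (allVecs-All PL m))) PL))

negV : {n : ℕ} → Vec ℤ n → Vec ℤ n
negV = Vec.map -_

nonzeroRange-neg : (n : ℕ) → map -_ (nonzeroRange n) ↭ nonzeroRange n
nonzeroRange-neg n = ↭-trans (↭-reflexive negated) (++-comm negatives positives)
  where
  positives negatives : List ℤ
  positives = map (λ i → + suc i) (upTo n)
  negatives = map -[1+_] (upTo n)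

  negated : map -_ (positives ++ negatives) ≡ negatives ++ positives
  negated = trans (map-++ -_ positives negatives)
                  (cong₂ _++_ (sym (map-∘ (upTo n))) (sym (map-∘ (upTo n))))

-- Negation preserves absolute values, hence being a signed permutation.
isSignedPerm-neg : {n : ℕ} (v : Vec ℤ n) → isSignedPermᵇ (negV v) ≡ isSignedPermᵇ v
isSignedPerm-neg v = cong distinctᵇ (begin
  map ∣_∣ (toList (negV v))     ≡⟨ cong (map ∣_∣) (toList-map -_ v) ⟩
  map ∣_∣ (map -_ (toList v))   ≡⟨ map-∘ (toList v) ⟨
  map (∣_∣ ∘ -_) (toList v)     ≡⟨ map-cong ∣-i∣≡∣i∣ (toList v) ⟩
  map ∣_∣ (toList v)            ∎)
  where open ≡-Reasoning

map-filterᵇ : {A : Set} (p : A → Bool) (f : A → A) → (∀ x → p (f x) ≡ p x) →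
  (xs : List A) → map f (filterᵇ p xs) ≡ filterᵇ p (map f xs)
map-filterᵇ p f p-inv [] = refl
map-filterᵇ p f p-inv (x ∷ xs) rewrite p-inv x with p x
... | true  = cong (f x ∷_) (map-filterᵇ p f p-inv xs)
... | false = map-filterᵇ p f p-inv xs

signedPerms-neg : (n : ℕ) → map negV (signedPerms n) ↭ signedPerms n
signedPerms-neg n = ↭-trans (↭-reflexive (trans commute negate-entries))
                            (filter-↭ (T? ∘ isSignedPermᵇ) (allVecs-↭ (nonzeroRange-neg n) n))
  where
  commute : map negV (signedPerms n) ≡ filterᵇ isSignedPermᵇ (map negV (allVecs (nonzeroRange n) n))
  commute = map-filterᵇ isSignedPermᵇ negV isSignedPerm-neg (allVecs (nonzeroRange n) n)

  negate-entries : filterᵇ isSignedPermᵇ (map negV (allVecs (nonzeroRange n) n))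
                 ≡ filterᵇ isSignedPermᵇ (allVecs (map -_ (nonzeroRange n)) n)
  negate-entries = cong (filterᵇ isSignedPermᵇ) (sym (allVecs-map -_ (nonzeroRange n) n))

<ᵇ-neg : (x y : ℤ) → (- y <ᵇ - x) ≡ (x <ᵇ y)
<ᵇ-neg x y = begin
  isYes (- y <? - x) ≡⟨ isYes≗does (- y <? - x) ⟩
  does (- y <? - x)  ≡⟨ does-⇔ (mk⇔ neg-cancel-< neg-mono-<) (- y <? - x) (x <? y) ⟩
  does (x <? y)      ≡⟨ isYes≗does (x <? y) ⟨
  isYes (x <? y)     ∎
  where open ≡-Reasoning

exactly-one-< : {x y : ℤ} → x ≢ y → χ (y <ᵇ x) + χ (x <ᵇ y) ≡ 1
exactly-one-< {x} {y} x≢y with x <? y | y <? x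
... | yes x<y | yes y<x = ⊥-elim (<-asym x<y y<x)
... | yes _   | no _    = refl
... | no _    | yes _   = refl
... | no x≮y  | no y≮x  = ⊥-elim (x≢y (≤-antisym (≮⇒≥ y≮x) (≮⇒≥ x≮y)))

+-interchange : (a b c d : ℕ) → a + b + (c + d) ≡ (a + c) + (b + d)
+-interchange = solve-∀

-- In a sequence with distinct neighbours each adjacent pair is a descent
-- either of the sequence or of its negation.
descList-neg : (l : List ℤ) → Linked _≢_ l → descList l + descList (map -_ l) ≡ pred (length l)
descList-neg []           []  = refl
descList-neg (x ∷ [])     [-] = refl
descList-neg (x ∷ y ∷ ys) (x≢y ∷ linked) = begin
  χ (y <ᵇ x) + descList (y ∷ ys) + (χ (- y <ᵇ - x) + descList (map -_ (y ∷ ys)))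
    ≡⟨ cong (λ b → χ (y <ᵇ x) + descList (y ∷ ys) + (χ b + descList (map -_ (y ∷ ys)))) (<ᵇ-neg x y) ⟩
  χ (y <ᵇ x) + descList (y ∷ ys) + (χ (x <ᵇ y) + descList (map -_ (y ∷ ys)))
    ≡⟨ +-interchange (χ (y <ᵇ x)) (descList (y ∷ ys)) (χ (x <ᵇ y)) (descList (map -_ (y ∷ ys))) ⟩
  (χ (y <ᵇ x) + χ (x <ᵇ y)) + (descList (y ∷ ys) + descList (map -_ (y ∷ ys)))
    ≡⟨ cong₂ _+_ (exactly-one-< x≢y) (descList-neg (y ∷ ys) linked) ⟩
  suc (length ys)
    ∎
  where open ≡-Reasoning

-- A nonzero integer is negative in exactly one of l and its negation.
negatives-neg : (l : List ℤ) → All (_≢ + 0) l →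
  count (_<ᵇ + 0) l + count (_<ᵇ + 0) (map -_ l) ≡ length l
negatives-neg [] [] = refl
negatives-neg (x ∷ xs) (x≢0 ∷ nonzero) = begin
  count (_<ᵇ + 0) (x ∷ xs) + count (_<ᵇ + 0) (- x ∷ map -_ xs)
    ≡⟨ cong₂ _+_ (count-∷ (_<ᵇ + 0) x xs) (count-∷ (_<ᵇ + 0) (- x) (map -_ xs)) ⟩
  χ (x <ᵇ + 0) + count (_<ᵇ + 0) xs + (χ (- x <ᵇ + 0) + count (_<ᵇ + 0) (map -_ xs))
    ≡⟨ cong (λ b → χ (x <ᵇ + 0) + count (_<ᵇ + 0) xs + (χ b + count (_<ᵇ + 0) (map -_ xs))) (<ᵇ-neg (+ 0) x) ⟩
  χ (x <ᵇ + 0) + count (_<ᵇ + 0) xs + (χ (+ 0 <ᵇ x) + count (_<ᵇ + 0) (map -_ xs))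
    ≡⟨ +-interchange (χ (x <ᵇ + 0)) (count (_<ᵇ + 0) xs) (χ (+ 0 <ᵇ x)) (count (_<ᵇ + 0) (map -_ xs)) ⟩
  (χ (x <ᵇ + 0) + χ (+ 0 <ᵇ x)) + (count (_<ᵇ + 0) xs + count (_<ᵇ + 0) (map -_ xs))
    ≡⟨ cong₂ _+_ (exactly-one-< (≢-sym x≢0)) (negatives-neg xs nonzero) ⟩
  suc (length xs)
    ∎
  where open ≡-Reasoning

not-member-head : (a b : ℕ) (bs : List ℕ) → T (not (memᵇ a (b ∷ bs))) → a ≢ b
not-member-head a b bs fresh a≡b with a ≡ᵇ b | ≡⇒≡ᵇ a b a≡b
... | true  | _ = fresh
... | false | ()

distinct⇒linked : (l : List ℤ) → T (distinctᵇ (map ∣_∣ l)) → Linked _≢_ l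
distinct⇒linked []           _ = []
distinct⇒linked (x ∷ [])     _ = [-]
distinct⇒linked (x ∷ y ∷ ys) distinct =
  (not-member-head ∣ x ∣ ∣ y ∣ (map ∣_∣ ys) (proj₁ split) ∘ cong ∣_∣)
    ∷ distinct⇒linked (y ∷ ys) (proj₂ split)
  where
  split : T (not (memᵇ ∣ x ∣ (map ∣_∣ (y ∷ ys)))) × T (distinctᵇ (map ∣_∣ (y ∷ ys)))
  split = Equivalence.to T-∧ distinct

prepend-zero : (l : List ℤ) → All (_≢ + 0) l → Linked _≢_ l → Linked _≢_ (+ 0 ∷ l)
prepend-zero []       []            []     = [-]
prepend-zero (y ∷ ys) (y≢0 ∷ _)     linked = ≢-sym y≢0 ∷ linked

Complementary : {n : ℕ} → Vec ℤ n → Set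
Complementary {n} v = (negCount v + negCount (negV v) ≡ n) × (desc v + desc (negV v) ≡ n)

complementary : {n : ℕ} (v : Vec ℤ n) → All (_≢ + 0) (toList v) →
  T (isSignedPermᵇ v) → Complementary v
complementary {n} v nonzero signed = negatives , descents
  where
  open ≡-Reasoning
  negatives : negCount v + negCount (negV v) ≡ n
  negatives = begin
    count (_<ᵇ + 0) (toList v) + count (_<ᵇ + 0) (toList (negV v))
      ≡⟨ cong (λ l → count (_<ᵇ + 0) (toList v) + count (_<ᵇ + 0) l) (toList-map -_ v) ⟩
    count (_<ᵇ + 0) (toList v) + count (_<ᵇ + 0) (map -_ (toList v))
      ≡⟨ negatives-neg (toList v) nonzero ⟩
    length (toList v)
      ≡⟨ length-toList v ⟩
    n ∎

  linked : Linked _≢_ (+ 0 ∷ toList v)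
  linked = prepend-zero (toList v) nonzero (distinct⇒linked (toList v) signed)

  descents : desc v + desc (negV v) ≡ n
  descents = begin
    descList (+ 0 ∷ toList v) + descList (+ 0 ∷ toList (negV v))
      ≡⟨ cong (λ l → descList (+ 0 ∷ toList v) + descList (+ 0 ∷ l)) (toList-map -_ v) ⟩
    descList (+ 0 ∷ toList v) + descList (map -_ (+ 0 ∷ toList v))
      ≡⟨ descList-neg (+ 0 ∷ toList v) linked ⟩
    length (toList v)
      ≡⟨ length-toList v ⟩
    n ∎

signedPerms-complementary : (n : ℕ) → All Complementary (signedPerms n)
signedPerms-complementary n =
  All.zipWith (λ (nonzero , signed) → complementary _ nonzero signed)
    (AllP.filter⁺ (T? ∘ isSignedPermᵇ) (allVecs-All range-nonzero n) ,
     all-filter (T? ∘ isSignedPermᵇ) (allVecs (nonzeroRange n) n))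
  where
  range-nonzero : All (_≢ + 0) (nonzeroRange n)
  range-nonzero = AllP.++⁺ (AllP.map⁺ (All.universal (λ _ ()) (upTo n)))
                           (AllP.map⁺ (All.universal (λ _ ()) (upTo n)))

≡ᵇ-complement : (c d n k : ℕ) → c + d ≡ n → k ≤ n → (d ≡ᵇ k) ≡ (c ≡ᵇ n ∸ k)
≡ᵇ-complement c d n k c+d≡n k≤n = does-⇔ (mk⇔ to from) (d ≟ k) (c ≟ n ∸ k)
  where
  open ≡-Reasoning
  to : d ≡ k → c ≡ n ∸ k
  to refl = begin
    c          ≡⟨ m+n∸n≡m c d ⟨
    c + d ∸ d  ≡⟨ cong (_∸ d) c+d≡n ⟩
    n ∸ d      ∎
  from : c ≡ n ∸ k → d ≡ k
  from refl = begin
    d                    ≡⟨ m+n∸m≡n (n ∸ k) d ⟨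
    n ∸ k + d ∸ (n ∸ k)  ≡⟨ cong (_∸ (n ∸ k)) c+d≡n ⟩
    n ∸ (n ∸ k)          ≡⟨ m∸[m∸n]≡n k≤n ⟩
    k                    ∎

-- Hence counting σ ∈ B_n by (neg, desc) through σ ↦ -σ: a condition on
-- (neg, desc) = (b, k) becomes one on the complementary (a, n - k).
count-symmetry : (n k : ℕ) → k ≤ n → (e e′ : ℕ → Bool) →
  (∀ a b → a + b ≡ n → e b ≡ e′ a) →
  count (λ v → e (negCount v) ∧ (desc v ≡ᵇ k)) (signedPerms n)
    ≡ count (λ v → e′ (negCount v) ∧ (desc v ≡ᵇ n ∸ k)) (signedPerms n)
count-symmetry n k k≤n e e′ e-complement =
  trans (count-image _ negV (signedPerms-neg n))
        (count-cong (All.map (λ {v} (negatives , descents) →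
                                cong₂ _∧_ (e-complement (negCount v) (negCount (negV v)) negatives)
                                          (≡ᵇ-complement (desc v) (desc (negV v)) n k descents k≤n))
                             (signedPerms-complementary n)))

mutual
  parity-complement-even : (a b : ℕ) → evenᵇ (a + b) ≡ true → evenᵇ b ≡ evenᵇ a
  parity-complement-even zero    b even = even
  parity-complement-even (suc a) b even = parity-complement-odd a b (not-injective even)

  parity-complement-odd : (a b : ℕ) → evenᵇ (a + b) ≡ false → evenᵇ b ≡ not (evenᵇ a)
  parity-complement-odd zero    b odd = odd
  parity-complement-odd (suc a) b odd =
    trans (parity-complement-even a b (not-injective odd)) (sym (not-involutive (evenᵇ a)))

Even⇒evenᵇ : {n : ℕ} → Even n → evenᵇ n ≡ true
Even⇒evenᵇ even0       = refl
Even⇒evenᵇ (even+2 ev) = trans (not-involutive _) (Even⇒evenᵇ ev)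

Odd⇒evenᵇ : {n : ℕ} → Odd n → evenᵇ n ≡ false
Odd⇒evenᵇ odd = not-injective (Even⇒evenᵇ odd)

oddᵇ : ℕ → Bool
oddᵇ m = not (evenᵇ m)

proposition4p1 : (n k : ℕ) → k ≤ n →
    (Even n → (D n k ≡ D n (n ∸ k)) × (D̃ n k ≡ D̃ n (n ∸ k))) ×
    (Odd n → (D n k ≡ D̃ n (n ∸ k)) × (D̃ n k ≡ D n (n ∸ k)))
proposition4p1 n k k≤n = even-case , odd-case
  where
  even-case : Even n → (D n k ≡ D n (n ∸ k)) × (D̃ n k ≡ D̃ n (n ∸ k))
  even-case ev = count-symmetry n k k≤n evenᵇ evenᵇ same
              , count-symmetry n k k≤n oddᵇ oddᵇ (λ a b a+b≡n → cong not (same a b a+b≡n))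
    where
    same : ∀ a b → a + b ≡ n → evenᵇ b ≡ evenᵇ a
    same a b a+b≡n = parity-complement-even a b (trans (cong evenᵇ a+b≡n) (Even⇒evenᵇ ev))

  odd-case : Odd n → (D n k ≡ D̃ n (n ∸ k)) × (D̃ n k ≡ D n (n ∸ k))
  odd-case od = count-symmetry n k k≤n evenᵇ oddᵇ opposite
              , count-symmetry n k k≤n oddᵇ evenᵇ
                  (λ a b a+b≡n → trans (cong not (opposite a b a+b≡n)) (not-involutive (evenᵇ a)))
    where
    opposite : ∀ a b → a + b ≡ n → evenᵇ b ≡ oddᵇ a
    opposite a b a+b≡n = parity-complement-odd a b (trans (cong evenᵇ a+b≡n) (Odd⇒evenᵇ od))
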